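{- Let $k,r,d$ be positive integers with $k\ge r$. Then ${\rm conv}(W^k_d S^{k2^d}_r)=[0,r]^d$ is a cube, and hence $u_r^k(d)=2^d$.
   Context: For $n\ge r$, $S^n_r\subset\{0,1\}^n$ denotes the uniform matroid, i.e., the set of all $x\in\{0,1\}^n$ with exactly $r$ entries equal to $1$. $W^k_d$ denotes the $d\times k2^d$ $\{0,1\}$-matrix whose $k2^d$ columns consist of exactly $k$ copies of each vector in $\{0,1\}^d$ (in any order). $u_r^k(d)$ denotes the number of vertices of ${\rm conv}(W^k_dS^{k2^d}_r)={\rm conv}\{W^k_dx : x\in S^{k2^d}_r\}$.
   Formalization: The convex hull, the cube $[0,r]^d$ and its vertices are taken over ℚ^d, with rational coefficients in the convex combinations. -}

module Defs where

open import Data.Bool using (Bool; true; false; if_then_else_; _∧_)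
open import Data.Nat as ℕ using (ℕ; _^_; _≡ᵇ_)
open import Data.Nat.DivMod using (_%_; _/_)
open import Data.Fin as Fin using (Fin; toℕ; remainder)
open import Data.Vec as Vec using (Vec; []; _∷_; lookup; tabulate; allFin; map; zipWith; replicate)
open import Data.List as List using (List; length)
open import Data.List.Relation.Unary.All as LAll using ()
open import Data.List.Relation.Unary.Unique.Propositional using (Unique)
open import Data.List.Membership.Propositional using (_∈_)
open import Data.Integer using (+_)
open import Data.Rational as ℚ using (ℚ; 0ℚ; 1ℚ; _+_; _*_; _-_; _≤_; _<_)
open import Data.Product using (Σ; ∃; _×_; _,_; proj₁; proj₂)
open import Relation.Binary.PropositionalEquality using (_≡_)
open import Function.Bundles using (_⇔_)

ℕ→ℚ : ℕ → ℚ
ℕ→ℚ n = (+ n) ℚ./ 1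

-- the d lowest binary digits of n (a bijection Fin (2^d) ≅ {0,1}^d)
bits : (d : ℕ) → ℕ → Vec Bool d
bits ℕ.zero    n = []
bits (ℕ.suc d) n = (n % 2 ≡ᵇ 1) ∷ bits d (n / 2)

-- column j of W^k_d : columns indexed by Fin (k * 2^d); column j is the
-- binary vector of (j mod 2^d), so each vector of {0,1}^d occurs exactly k times
col : (k d : ℕ) → Fin (k ℕ.* (2 ^ d)) → Vec Bool d
col k d j = bits d (toℕ (remainder {k} (2 ^ d) j))

ones : {n : ℕ} → Vec Bool n → ℕ
ones x = Vec.sum (map (λ b → if b then 1 else 0) x)

-- the uniform matroid S^n_r (as a predicate on {0,1}^n)
S : (n r : ℕ) → Vec Bool n → Set
S n r x = ones x ≡ r

W* : (k d : ℕ) → Vec Bool (k ℕ.* (2 ^ d)) → Vec ℕ d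
W* k d x = tabulate λ i →
  Vec.sum (map (λ j → if lookup x j ∧ lookup (col k d j) i then 1 else 0)
               (allFin (k ℕ.* (2 ^ d))))

WS : (k r d : ℕ) → Vec ℚ d → Set
WS k r d y = Σ (Vec Bool (k ℕ.* (2 ^ d))) λ x →
  S (k ℕ.* (2 ^ d)) r x × map ℕ→ℚ (W* k d x) ≡ y

_⊕_ : {d : ℕ} → Vec ℚ d → Vec ℚ d → Vec ℚ d
_⊕_ = zipWith _+_

_⊙_ : {d : ℕ} → ℚ → Vec ℚ d → Vec ℚ d
t ⊙ v = map (t *_) v

𝟘 : {d : ℕ} → Vec ℚ d
𝟘 = replicate _ 0ℚ

Conv : {d : ℕ} → (Vec ℚ d → Set) → Vec ℚ d → Set
Conv {d} P y = Σ (List (ℚ × Vec ℚ d)) λ cs →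
    LAll.All (λ c → 0ℚ ≤ proj₁ c × P (proj₂ c)) cs
  × List.foldr (λ c s → proj₁ c + s) 0ℚ cs ≡ 1ℚ
  × List.foldr (λ c s → (proj₁ c ⊙ proj₂ c) ⊕ s) 𝟘 cs ≡ y

Cube : (r d : ℕ) → Vec ℚ d → Set
Cube r d y = ∀ i → 0ℚ ≤ lookup y i × lookup y i ≤ ℕ→ℚ r

IsVertex : {d : ℕ} → (Vec ℚ d → Set) → Vec ℚ d → Set
IsVertex C v = C v × (∀ a b t → C a → C b → 0ℚ < t → t < 1ℚ →
  v ≡ (t ⊙ a) ⊕ ((1ℚ - t) ⊙ b) → a ≡ b)

NumVertices : {d : ℕ} → (Vec ℚ d → Set) → ℕ → Set
NumVertices {d} C m = Σ (List (Vec ℚ d)) λ vs →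
  Unique vs × length vs ≡ m × (∀ v → (v ∈ vs) ⇔ IsVertex C v)

-- Every point W x with x ∈ S_r has coordinates in [0, r]: its i-th coordinate counts some of the
-- r ones of x.  Conversely, since every column of W occurs k ≥ r times, each corner of [0, r]^d
-- is such a point: put the r ones of x on r copies of the column whose entries mark where the
-- corner equals r.  The cube being convex and the convex hull of its corners, conv(W S_r) is the
-- cube [0, r]^d, whose vertices are exactly its 2^d corners.
module Submission where

open import Defs
open import Data.Bool using (Bool; true; false; if_then_else_; _∧_)
open import Data.Bool.Properties using (∧-identityʳ)
open import Data.Empty using (⊥-elim)
open import Data.Fin as Fin using (Fin; toℕ; _↑ˡ_; _↑ʳ_; combine; remQuot; quotient; remainder)
import Data.Fin.Properties as FinP
open import Data.Integer as ℤ using (+_)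
import Data.Integer.Properties as ℤP
open import Data.List as List using (List)
import Data.List.Properties as LP
open import Data.List.Membership.Propositional using (_∈_)
open import Data.List.Membership.Propositional.Properties using (∈-map⁺; ∈-map⁻; ∈-++⁺ˡ; ∈-++⁺ʳ; ∈-++⁻)
open import Data.List.Relation.Unary.All as All using ([]; _∷_)
import Data.List.Relation.Unary.AllPairs as AllPairs
open import Data.List.Relation.Unary.Any using (here)
open import Data.List.Relation.Unary.Unique.Propositional using (Unique)
import Data.List.Relation.Unary.Unique.Propositional.Properties as UniqueP
open import Data.Nat as ℕ using (ℕ; zero; suc; _^_; _<ᵇ_)
open import Data.Nat.Coprimality as Coprime using (1-coprimeTo)
open import Data.Nat.DivMod using (_%_; _/_; [m+kn]%n≡m%n; +-distrib-/-∣ʳ; m*n/n≡m; m<n⇒m/n≡0)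
open import Data.Nat.Divisibility using (n∣m*n)
import Data.Nat.Properties as ℕP
open import Algebra.Properties.CommutativeMonoid.Sum ℕP.+-0-commutativeMonoid
  using (sum; sum-syntax; sum-cong-≗; sum-replicate-zero; sum-remove)
open import Data.Product using (_×_; _,_; proj₁; proj₂; uncurry)
open import Data.Rational as ℚ using (ℚ; 0ℚ; 1ℚ; _+_; _*_; _-_; -_; 1/_; _≤_; _<_; mkℚ)
import Data.Rational.Properties as ℚP
open import Data.Rational.Solver using (module +-*-Solver)
open import Data.Sum using (_⊎_; inj₁; inj₂)
open import Data.Vec as Vec using (Vec; []; _∷_; lookup; tabulate; map; _[_]≔_)
open import Data.Vec.Properties
  using (lookup∘tabulate; tabulate∘lookup; tabulate-cong; lookup-map; lookup-zipWith;
         lookup∘update; lookup∘update′; lookup-replicate; ∷-injectiveˡ; ∷-injectiveʳ)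
open import Function using (_∘_; id; case_of_)
open import Function.Bundles using (_⇔_; mk⇔; Equivalence)
import Function.Properties.Equivalence as ⇔
open import Relation.Binary.Definitions using (tri<; tri≈; tri>)
open import Relation.Binary.PropositionalEquality
open import Relation.Nullary using (yes; no; does; ¬_)
open import Relation.Nullary.Decidable using (dec-true; dec-false)
open +-*-Solver

private variable
  d : ℕ
  p q t a b : ℚ

sum-map-tabulate : ∀ {A : Set} n (f : A → ℕ) (g : Fin n → A) →
  Vec.sum (map f (tabulate g)) ≡ ∑[ j < n ] f (g j)
sum-map-tabulate zero    f g = refl
sum-map-tabulate (suc n) f g = cong (f (g Fin.zero) ℕ.+_) (sum-map-tabulate n f (g ∘ Fin.suc))

sum-mono-≤ : ∀ {n} {f g : Fin n → ℕ} → (∀ j → f j ℕ.≤ g j) → sum f ℕ.≤ sum g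
sum-mono-≤ {zero}  f≤g = ℕ.z≤n
sum-mono-≤ {suc n} f≤g = ℕP.+-mono-≤ (f≤g Fin.zero) (sum-mono-≤ (f≤g ∘ Fin.suc))

sum-↑ : ∀ m n (f : Fin (m ℕ.+ n) → ℕ) →
  sum f ≡ ∑[ i < m ] f (i ↑ˡ n) ℕ.+ ∑[ j < n ] f (m ↑ʳ j)
sum-↑ zero    n f = refl
sum-↑ (suc m) n f = trans (cong (f Fin.zero ℕ.+_) (sum-↑ m n (f ∘ Fin.suc)))
                          (sym (ℕP.+-assoc (f Fin.zero) _ _))

sum-combine : ∀ m n (f : Fin (m ℕ.* n) → ℕ) →
  sum f ≡ ∑[ q < m ] ∑[ ρ < n ] f (combine q ρ)
sum-combine zero    n f = refl
sum-combine (suc m) n f = trans (sum-↑ n (m ℕ.* n) f)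
  (cong (∑[ ρ < n ] f (ρ ↑ˡ m ℕ.* n) ℕ.+_) (sum-combine m n (f ∘ (n ↑ʳ_))))

sum-remQuot : ∀ m n (F : Fin m → Fin n → ℕ) →
  ∑[ j < m ℕ.* n ] uncurry F (remQuot n j) ≡ ∑[ q < m ] ∑[ ρ < n ] F q ρ
sum-remQuot m n F = trans (sum-combine m n (uncurry F ∘ remQuot n))
  (sum-cong-≗ λ q → sum-cong-≗ λ ρ → cong (uncurry F) (FinP.remQuot-combine q ρ))

sum-single : ∀ {n} (i : Fin n) (f : Fin n → ℕ) → (∀ j → j ≢ i → f j ≡ 0) → sum f ≡ f i
sum-single {suc n} i f f≡0 = begin
  sum f                                   ≡⟨ sum-remove {i = i} f ⟩
  f i ℕ.+ ∑[ j < n ] f (Fin.punchIn i j)  ≡⟨ cong (f i ℕ.+_) (sum-cong-≗ λ j → f≡0 _ (FinP.punchInᵢ≢i i j)) ⟩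
  f i ℕ.+ ∑[ j < n ] 0                    ≡⟨ cong (f i ℕ.+_) (sum-replicate-zero n) ⟩
  f i ℕ.+ 0                               ≡⟨ ℕP.+-identityʳ (f i) ⟩
  f i                                     ∎
  where open ≡-Reasoning

sum-initial-segment : ∀ {k r} c → r ℕ.≤ k → ∑[ q < k ] (if toℕ q <ᵇ r then c else 0) ≡ r ℕ.* c
sum-initial-segment {k}     {zero}  c _           = sum-replicate-zero k
sum-initial-segment {suc k} {suc r} c (ℕ.s≤s r≤k) = cong (c ℕ.+_) (sum-initial-segment c r≤k)

ℕ→ℚ≡mkℚ : ∀ n → ℕ→ℚ n ≡ mkℚ (+ n) 0 (Coprime.sym (1-coprimeTo n))
ℕ→ℚ≡mkℚ n = ℚP.normalize-coprime (Coprime.sym (1-coprimeTo n))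

ℕ→ℚ-mono-≤ : ∀ {m n} → m ℕ.≤ n → ℕ→ℚ m ≤ ℕ→ℚ n
ℕ→ℚ-mono-≤ {m} {n} m≤n rewrite ℕ→ℚ≡mkℚ m | ℕ→ℚ≡mkℚ n =
  ℚ.*≤* (subst₂ ℤ._≤_ (sym (ℤP.*-identityʳ (+ m))) (sym (ℤP.*-identityʳ (+ n))) (ℤ.+≤+ m≤n))

ℕ→ℚ-pos : ∀ {n} → 1 ℕ.≤ n → 0ℚ < ℕ→ℚ n
ℕ→ℚ-pos {suc n} _ rewrite ℕ→ℚ≡mkℚ (suc n) = ℚP.positive⁻¹ _

*-nonNeg : 0ℚ ≤ p → 0ℚ ≤ q → 0ℚ ≤ p * q
*-nonNeg {p} {q} 0≤p 0≤q =
  ℚP.nonNegative⁻¹ _ {{ℚP.nonNeg*nonNeg⇒nonNeg p {{ℚ.nonNegative 0≤p}} q {{ℚ.nonNegative 0≤q}}}}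

p≤q⇒0≤q-p : p ≤ q → 0ℚ ≤ q - p
p≤q⇒0≤q-p {p} {q} p≤q = subst (_≤ q - p) (ℚP.+-inverseʳ p) (ℚP.+-monoˡ-≤ (- p) p≤q)

p<q⇒0<q-p : p < q → 0ℚ < q - p
p<q⇒0<q-p {p} {q} p<q = subst (_< q - p) (ℚP.+-inverseʳ p) (ℚP.+-monoˡ-< (- p) p<q)

≤∧≢⇒< : p ≤ q → p ≢ q → p < q
≤∧≢⇒< {p} {q} p≤q p≢q with ℚP.<-cmp p q
... | tri< p<q _ _ = p<q
... | tri≈ _ p≡q _ = ⊥-elim (p≢q p≡q)
... | tri> _ _ q<p = ⊥-elim (ℚP.<-irrefl refl (ℚP.<-≤-trans q<p p≤q))

nonNeg+nonNeg≡0⇒≡0 : 0ℚ ≤ p → 0ℚ ≤ q → p + q ≡ 0ℚ → p ≡ 0ℚ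
nonNeg+nonNeg≡0⇒≡0 {p} {q} 0≤p 0≤q p+q≡0 = ℚP.≤-antisym p≤0 0≤p
  where
  p≤0 : p ≤ 0ℚ
  p≤0 = subst (p ≤_) p+q≡0 (subst (_≤ p + q) (ℚP.+-identityʳ p) (ℚP.+-monoʳ-≤ p 0≤q))

pos*nonNeg≡0⇒≡0 : 0ℚ < p → 0ℚ ≤ q → p * q ≡ 0ℚ → q ≡ 0ℚ
pos*nonNeg≡0⇒≡0 {p} {q} 0<p 0≤q pq≡0 = ℚP.≤-antisym q≤0 0≤q
  where
  q≤0 : q ≤ 0ℚ
  q≤0 = ℚP.*-cancelˡ-≤-pos p {{ℚ.positive 0<p}} (ℚP.≤-reflexive (trans pq≡0 (sym (ℚP.*-zeroʳ p))))

p*1/q*q≡p : ∀ p q .{{_ : ℚ.NonZero q}} → p * 1/ q * q ≡ p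
p*1/q*q≡p p q = begin
  p * 1/ q * q    ≡⟨ ℚP.*-assoc p (1/ q) q ⟩
  p * (1/ q * q)  ≡⟨ cong (p *_) (ℚP.*-inverseˡ q) ⟩
  p * 1ℚ          ≡⟨ ℚP.*-identityʳ p ⟩
  p               ∎
  where open ≡-Reasoning

p≤q⇒p*1/q≤1 : ∀ {p q} .{{_ : ℚ.Positive q}} → p ≤ q → p * (1/ q) {{ℚP.pos⇒nonZero q}} ≤ 1ℚ
p≤q⇒p*1/q≤1 {q = q} p≤q = ℚP.≤-trans
  (ℚP.*-monoʳ-≤-nonNeg 1/q {{ℚP.pos⇒nonNeg 1/q {{ℚP.1/pos⇒pos q}}}} p≤q)
  (ℚP.≤-reflexive (ℚP.*-inverseʳ q {{ℚP.pos⇒nonZero q}}))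
  where 1/q = (1/ q) {{ℚP.pos⇒nonZero q}}

p<q⇒p*1/q<1 : ∀ {p q} .{{_ : ℚ.Positive q}} → p < q → p * (1/ q) {{ℚP.pos⇒nonZero q}} < 1ℚ
p<q⇒p*1/q<1 {q = q} p<q = ℚP.<-≤-trans
  (ℚP.*-monoˡ-<-pos 1/q {{ℚP.1/pos⇒pos q}} p<q)
  (ℚP.≤-reflexive (ℚP.*-inverseʳ q {{ℚP.pos⇒nonZero q}}))
  where 1/q = (1/ q) {{ℚP.pos⇒nonZero q}}

Box : ℚ → (d : ℕ) → Vec ℚ d → Set
Box R d y = ∀ i → 0ℚ ≤ lookup y i × lookup y i ≤ R

IsCorner : ℚ → (d : ℕ) → Vec ℚ d → Set
IsCorner R d y = ∀ i → lookup y i ≡ 0ℚ ⊎ lookup y i ≡ R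

weight : List (ℚ × Vec ℚ d) → ℚ
weight = List.foldr (λ c s → proj₁ c + s) 0ℚ

combination : List (ℚ × Vec ℚ d) → Vec ℚ d
combination = List.foldr (λ c s → (proj₁ c ⊙ proj₂ c) ⊕ s) 𝟘

lookup-ext : ∀ {A : Set} {n} {u v : Vec A n} → (∀ i → lookup u i ≡ lookup v i) → u ≡ v
lookup-ext {u = u} {v} eq = trans (sym (tabulate∘lookup u)) (trans (tabulate-cong eq) (tabulate∘lookup v))

lookup-⊕ : ∀ (u v : Vec ℚ d) i → lookup (u ⊕ v) i ≡ lookup u i + lookup v i
lookup-⊕ u v i = lookup-zipWith _+_ i u v

lookup-⊙ : ∀ t (u : Vec ℚ d) i → lookup (t ⊙ u) i ≡ t * lookup u i
lookup-⊙ t u i = lookup-map i (t *_) u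

lookup-⊕-⊙ : ∀ s (u : Vec ℚ d) t (v : Vec ℚ d) i →
  lookup ((s ⊙ u) ⊕ (t ⊙ v)) i ≡ s * lookup u i + t * lookup v i
lookup-⊕-⊙ s u t v i = trans (lookup-⊕ (s ⊙ u) (t ⊙ v) i) (cong₂ _+_ (lookup-⊙ s u i) (lookup-⊙ t v i))

⊙-⊕-merge : ∀ a b (z w : Vec ℚ d) → (a ⊙ z) ⊕ ((b ⊙ z) ⊕ w) ≡ ((a + b) ⊙ z) ⊕ w
⊙-⊕-merge a b []      []      = refl
⊙-⊕-merge a b (x ∷ z) (y ∷ w) = cong₂ _∷_
  (solve 4 (λ a b x y → a :* x :+ (b :* x :+ y) := (a :+ b) :* x :+ y) refl a b x y)
  (⊙-⊕-merge a b z w)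

Conv-mono : {P Q : Vec ℚ d → Set} → (∀ z → P z → Q z) → ∀ y → Conv P y → Conv Q y
Conv-mono P⊆Q y (cs , valid , weight≡1 , combination≡y) =
  cs , All.map (λ { (0≤t , Pz) → 0≤t , P⊆Q _ Pz }) valid , weight≡1 , combination≡y

combination-bounds : ∀ R (i : Fin d) cs → All.All (λ c → 0ℚ ≤ proj₁ c × Box R d (proj₂ c)) cs →
  0ℚ ≤ lookup (combination cs) i × lookup (combination cs) i ≤ R * weight cs
combination-bounds R i List.[] [] =
  ℚP.≤-reflexive (sym (lookup-replicate i 0ℚ)) ,
  ℚP.≤-reflexive (trans (lookup-replicate i 0ℚ) (sym (ℚP.*-zeroʳ R)))
combination-bounds R i ((t , z) List.∷ cs) ((0≤t , z∈Box) ∷ valid)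
  with z∈Box i | combination-bounds R i cs valid
... | 0≤zᵢ , zᵢ≤R | 0≤rest , rest≤ =
  subst (λ x → 0ℚ ≤ x × x ≤ R * (t + weight cs)) (sym lookup-∷)
    (ℚP.+-mono-≤ (*-nonNeg 0≤t 0≤zᵢ) 0≤rest ,
     ℚP.≤-trans (ℚP.+-mono-≤ (ℚP.*-monoˡ-≤-nonNeg t {{ℚ.nonNegative 0≤t}} zᵢ≤R) rest≤)
                (ℚP.≤-reflexive (solve 3 (λ R t w → t :* R :+ R :* w := R :* (t :+ w)) refl R t (weight cs))))
  where
  lookup-∷ : lookup ((t ⊙ z) ⊕ combination cs) i ≡ t * lookup z i + lookup (combination cs) i
  lookup-∷ = trans (lookup-⊕ (t ⊙ z) (combination cs) i) (cong (_+ _) (lookup-⊙ t z i))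

Box-convex : ∀ R y → Conv (Box R d) y → Box R d y
Box-convex R y (cs , valid , weight≡1 , refl) i with combination-bounds R i cs valid
... | 0≤yᵢ , yᵢ≤R*w = 0≤yᵢ , subst (_ ≤_) (trans (cong (R *_) weight≡1) (ℚP.*-identityʳ R)) yᵢ≤R*w

module _ (R : ℚ) where

  prependEndpoints : ℚ → List (ℚ × Vec ℚ d) → List (ℚ × Vec ℚ (suc d))
  prependEndpoints s List.[]              = List.[]
  prependEndpoints s ((t , z) List.∷ cs) =
    (t * (1ℚ - s) , 0ℚ ∷ z) List.∷ (t * s , R ∷ z) List.∷ prependEndpoints s cs

  weight-prependEndpoints : ∀ s (cs : List (ℚ × Vec ℚ d)) → weight (prependEndpoints s cs) ≡ weight cs
  weight-prependEndpoints s List.[] = refl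
  weight-prependEndpoints s ((t , z) List.∷ cs) =
    trans (cong (λ w → t * (1ℚ - s) + (t * s + w)) (weight-prependEndpoints s cs))
          (solve 3 (λ t s w → t :* (con 1ℚ :- s) :+ (t :* s :+ w) := t :+ w) refl t s (weight cs))

  combination-prependEndpoints : ∀ s (cs : List (ℚ × Vec ℚ d)) →
    combination (prependEndpoints s cs) ≡ (s * R * weight cs) ∷ combination cs
  combination-prependEndpoints s List.[] = cong (_∷ 𝟘) (sym (ℚP.*-zeroʳ (s * R)))
  combination-prependEndpoints s ((t , z) List.∷ cs) rewrite combination-prependEndpoints s cs =
    cong₂ _∷_
      (solve 4 (λ t s R w → t :* (con 1ℚ :- s) :* con 0ℚ :+ (t :* s :* R :+ s :* R :* w)
                            := s :* R :* (t :+ w)) refl t s R (weight cs))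
      (trans (⊙-⊕-merge (t * (1ℚ - s)) (t * s) z (combination cs))
             (cong (λ a → (a ⊙ z) ⊕ combination cs) (solve 2 (λ t s → t :* (con 1ℚ :- s) :+ t :* s := t) refl t s)))

  prependEndpoints-corners : ∀ s → 0ℚ ≤ s → s ≤ 1ℚ → (cs : List (ℚ × Vec ℚ d)) →
    All.All (λ c → 0ℚ ≤ proj₁ c × IsCorner R d (proj₂ c)) cs →
    All.All (λ c → 0ℚ ≤ proj₁ c × IsCorner R (suc d) (proj₂ c)) (prependEndpoints s cs)
  prependEndpoints-corners s 0≤s s≤1 List.[] [] = []
  prependEndpoints-corners s 0≤s s≤1 ((t , z) List.∷ cs) ((0≤t , z-corner) ∷ valid) =
    (*-nonNeg 0≤t (p≤q⇒0≤q-p s≤1) , λ { Fin.zero → inj₁ refl ; (Fin.suc i) → z-corner i }) ∷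
    (*-nonNeg 0≤t 0≤s             , λ { Fin.zero → inj₂ refl ; (Fin.suc i) → z-corner i }) ∷
    prependEndpoints-corners s 0≤s s≤1 cs valid

  Box⊆Conv-corners : 0ℚ < R → ∀ d y → Box R d y → Conv (IsCorner R d) y
  Box⊆Conv-corners 0<R zero [] _ =
    (1ℚ , []) List.∷ List.[] , (ℚP.nonNegative⁻¹ 1ℚ , λ ()) ∷ [] , refl , refl
  Box⊆Conv-corners 0<R (suc d) (y₀ ∷ y) y∈Box
    with Box⊆Conv-corners 0<R d y (y∈Box ∘ Fin.suc) | y∈Box Fin.zero
  ... | cs , valid , weight≡1 , refl | 0≤y₀ , y₀≤R =
    prependEndpoints s cs ,
    prependEndpoints-corners s 0≤s (p≤q⇒p*1/q≤1 y₀≤R) cs valid ,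
    trans (weight-prependEndpoints s cs) weight≡1 ,
    trans (combination-prependEndpoints s cs) (cong (_∷ combination cs)
      (trans (cong (s * R *_) weight≡1) (trans (ℚP.*-identityʳ (s * R)) (p*1/q*q≡p y₀ R))))
    where
    instance
      R-pos : ℚ.Positive R
      R-pos = ℚ.positive 0<R
      R≢0 : ℚ.NonZero R
      R≢0 = ℚP.pos⇒nonZero R
    s = y₀ * 1/ R
    0≤s : 0ℚ ≤ s
    0≤s = *-nonNeg 0≤y₀ (ℚP.nonNegative⁻¹ (1/ R) {{ℚP.pos⇒nonNeg (1/ R) {{ℚP.1/pos⇒pos R}}}})

IsVertex-resp-⇔ : {C D : Vec ℚ d → Set} → (∀ y → C y ⇔ D y) → ∀ v → IsVertex C v ⇔ IsVertex D v
IsVertex-resp-⇔ C⇔D v = mk⇔ (transport C⇔D) (transport (λ y → ⇔.sym (C⇔D y)))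
  where
  transport : ∀ {C D : Vec ℚ _ → Set} → (∀ y → C y ⇔ D y) → IsVertex C v → IsVertex D v
  transport C⇔D (v∈C , extreme) = Equivalence.to (C⇔D v) v∈C ,
    λ a b t a∈D b∈D → extreme a b t (Equivalence.from (C⇔D a) a∈D) (Equivalence.from (C⇔D b) b∈D)

convex-comb≡0 : 0ℚ < t → t < 1ℚ → 0ℚ ≤ a → 0ℚ ≤ b → t * a + (1ℚ - t) * b ≡ 0ℚ → a ≡ 0ℚ × b ≡ 0ℚ
convex-comb≡0 {t} {a} {b} 0<t t<1 0≤a 0≤b sum≡0 =
  pos*nonNeg≡0⇒≡0 0<t 0≤a (nonNeg+nonNeg≡0⇒≡0 0≤ta 0≤sb sum≡0) ,
  pos*nonNeg≡0⇒≡0 0<1-t 0≤b (nonNeg+nonNeg≡0⇒≡0 0≤sb 0≤ta (trans (ℚP.+-comm ((1ℚ - t) * b) (t * a)) sum≡0))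
  where
  0<1-t = p<q⇒0<q-p t<1
  0≤ta = *-nonNeg (ℚP.<⇒≤ 0<t) 0≤a
  0≤sb = *-nonNeg (ℚP.<⇒≤ 0<1-t) 0≤b

module _ {R : ℚ} where

  -- The endpoint R is reduced to the endpoint 0 by the reflection p ↦ R - p.
  endpoint-extreme : ∀ {x} → (x ≡ 0ℚ ⊎ x ≡ R) → 0ℚ < t → t < 1ℚ →
    0ℚ ≤ a × a ≤ R → 0ℚ ≤ b × b ≤ R → x ≡ t * a + (1ℚ - t) * b → a ≡ b
  endpoint-extreme (inj₁ refl) 0<t t<1 (0≤a , _) (0≤b , _) 0≡comb =
    let a≡0 , b≡0 = convex-comb≡0 0<t t<1 0≤a 0≤b (sym 0≡comb) in trans a≡0 (sym b≡0)
  endpoint-extreme {t} {a} {b} (inj₂ refl) 0<t t<1 (_ , a≤R) (_ , b≤R) R≡comb =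
    let R-a≡0 , R-b≡0 = convex-comb≡0 0<t t<1 (p≤q⇒0≤q-p a≤R) (p≤q⇒0≤q-p b≤R) reflected
    in trans (R-p≡0⇒p≡R R-a≡0) (sym (R-p≡0⇒p≡R R-b≡0))
    where
    open ≡-Reasoning
    reflected : t * (R - a) + (1ℚ - t) * (R - b) ≡ 0ℚ
    reflected = begin
      t * (R - a) + (1ℚ - t) * (R - b)  ≡⟨ solve 4 (λ t R a b → t :* (R :- a) :+ (con 1ℚ :- t) :* (R :- b)
                                                   := R :- (t :* a :+ (con 1ℚ :- t) :* b)) refl t R a b ⟩
      R - (t * a + (1ℚ - t) * b)        ≡⟨ cong (λ x → R - x) R≡comb ⟨
      R - R                             ≡⟨ ℚP.+-inverseʳ R ⟩
      0ℚ                                ∎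
    R-p≡0⇒p≡R : ∀ {p} → R - p ≡ 0ℚ → p ≡ R
    R-p≡0⇒p≡R {p} R-p≡0 = begin
      p            ≡⟨ solve 2 (λ R p → p := R :- (R :- p)) refl R p ⟩
      R - (R - p)  ≡⟨ cong (λ x → R - x) R-p≡0 ⟩
      R - 0ℚ       ≡⟨ ℚP.+-identityʳ R ⟩
      R            ∎

  corner⇒vertex : 0ℚ ≤ R → ∀ {d} (v : Vec ℚ d) → IsCorner R d v → IsVertex (Box R d) v
  corner⇒vertex 0≤R v v-corner = v∈Box , extreme
    where
    v∈Box : Box R _ v
    v∈Box i with v-corner i
    ... | inj₁ vᵢ≡0 = subst (λ x → 0ℚ ≤ x × x ≤ R) (sym vᵢ≡0) (ℚP.≤-refl , 0≤R)
    ... | inj₂ vᵢ≡R = subst (λ x → 0ℚ ≤ x × x ≤ R) (sym vᵢ≡R) (0≤R , ℚP.≤-refl)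
    extreme : ∀ a b t → Box R _ a → Box R _ b → 0ℚ < t → t < 1ℚ → v ≡ (t ⊙ a) ⊕ ((1ℚ - t) ⊙ b) → a ≡ b
    extreme a b t a∈Box b∈Box 0<t t<1 refl = lookup-ext λ i →
      endpoint-extreme (v-corner i) 0<t t<1 (a∈Box i) (b∈Box i) (lookup-⊕-⊙ t a (1ℚ - t) b i)

  Box-update : ∀ {d} {v : Vec ℚ d} {c} → Box R d v → 0ℚ ≤ c × c ≤ R → ∀ i → Box R d (v [ i ]≔ c)
  Box-update {v = v} {c} v∈Box c∈[0,R] i j with j Fin.≟ i
  ... | yes refl = subst (λ x → 0ℚ ≤ x × x ≤ R) (sym (lookup∘update i v c)) c∈[0,R]
  ... | no j≢i   = subst (λ x → 0ℚ ≤ x × x ≤ R) (sym (lookup∘update′ j≢i v c)) (v∈Box j)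

  -- With s = vᵢ / R, v is the s : (1 - s) combination of v with its i-th coordinate set to R and to 0.
  interior-not-vertex : 0ℚ < R → ∀ {d} (v : Vec ℚ d) i → 0ℚ < lookup v i → lookup v i < R →
    ¬ IsVertex (Box R d) v
  interior-not-vertex 0<R v i 0<vᵢ vᵢ<R (v∈Box , extreme) = ℚP.<⇒≢ 0<R (begin
    0ℚ                      ≡⟨ lookup∘update i v 0ℚ ⟨
    lookup (v [ i ]≔ 0ℚ) i  ≡⟨ cong (λ u → lookup u i) upper≡lower ⟨
    lookup (v [ i ]≔ R) i   ≡⟨ lookup∘update i v R ⟩
    R                       ∎)
    where
    open ≡-Reasoning
    instance
      R-pos : ℚ.Positive R
      R-pos = ℚ.positive 0<R
      R≢0 : ℚ.NonZero R
      R≢0 = ℚP.pos⇒nonZero R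
    s = lookup v i * 1/ R
    0<s : 0ℚ < s
    0<s = ℚP.positive⁻¹ s {{ℚP.pos*pos⇒pos (lookup v i) {{ℚ.positive 0<vᵢ}} (1/ R) {{ℚP.1/pos⇒pos R}}}}
    coordinate : ∀ j → s * lookup (v [ i ]≔ R) j + (1ℚ - s) * lookup (v [ i ]≔ 0ℚ) j ≡ lookup v j
    coordinate j with j Fin.≟ i
    ... | yes refl = begin
      s * lookup (v [ i ]≔ R) i + (1ℚ - s) * lookup (v [ i ]≔ 0ℚ) i
        ≡⟨ cong₂ (λ x y → s * x + (1ℚ - s) * y) (lookup∘update i v R) (lookup∘update i v 0ℚ) ⟩
      s * R + (1ℚ - s) * 0ℚ
        ≡⟨ solve 2 (λ s R → s :* R :+ (con 1ℚ :- s) :* con 0ℚ := s :* R) refl s R ⟩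
      lookup v i * 1/ R * R
        ≡⟨ p*1/q*q≡p (lookup v i) R ⟩
      lookup v i ∎
    ... | no j≢i = begin
      s * lookup (v [ i ]≔ R) j + (1ℚ - s) * lookup (v [ i ]≔ 0ℚ) j
        ≡⟨ cong₂ (λ x y → s * x + (1ℚ - s) * y) (lookup∘update′ j≢i v R) (lookup∘update′ j≢i v 0ℚ) ⟩
      s * lookup v j + (1ℚ - s) * lookup v j
        ≡⟨ solve 2 (λ s x → s :* x :+ (con 1ℚ :- s) :* x := x) refl s (lookup v j) ⟩
      lookup v j ∎
    upper≡lower : v [ i ]≔ R ≡ v [ i ]≔ 0ℚ
    upper≡lower = extreme (v [ i ]≔ R) (v [ i ]≔ 0ℚ) s
      (Box-update {v = v} v∈Box (ℚP.<⇒≤ 0<R , ℚP.≤-refl) i) (Box-update {v = v} v∈Box (ℚP.≤-refl , ℚP.<⇒≤ 0<R) i)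
      0<s (p<q⇒p*1/q<1 vᵢ<R)
      (lookup-ext λ j → sym (trans (lookup-⊕-⊙ s (v [ i ]≔ R) (1ℚ - s) (v [ i ]≔ 0ℚ) j) (coordinate j)))

  vertex⇒corner : 0ℚ < R → ∀ {d} (v : Vec ℚ d) → IsVertex (Box R d) v → IsCorner R d v
  vertex⇒corner 0<R v v-vertex i with proj₁ v-vertex i | lookup v i ℚP.≟ 0ℚ | lookup v i ℚP.≟ R
  ... | _          | yes vᵢ≡0 | _        = inj₁ vᵢ≡0
  ... | _          | no  _    | yes vᵢ≡R = inj₂ vᵢ≡R
  ... | 0≤vᵢ , vᵢ≤R | no  vᵢ≢0 | no  vᵢ≢R =
    ⊥-elim (interior-not-vertex 0<R v i (≤∧≢⇒< 0≤vᵢ (vᵢ≢0 ∘ sym)) (≤∧≢⇒< vᵢ≤R vᵢ≢R) v-vertex)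

  IsCorner⇔IsVertex : 0ℚ < R → ∀ {d} (v : Vec ℚ d) → IsCorner R d v ⇔ IsVertex (Box R d) v
  IsCorner⇔IsVertex 0<R v = mk⇔ (corner⇒vertex (ℚP.<⇒≤ 0<R) v) (vertex⇒corner 0<R v)

module _ (R : ℚ) where

  corners : (d : ℕ) → List (Vec ℚ d)
  corners zero    = [] List.∷ List.[]
  corners (suc d) = List.map (0ℚ ∷_) (corners d) List.++ List.map (R ∷_) (corners d)

  length-corners : ∀ d → List.length (corners d) ≡ 2 ^ d
  length-corners zero    = refl
  length-corners (suc d) = begin
    List.length (List.map (0ℚ ∷_) (corners d) List.++ List.map (R ∷_) (corners d))
      ≡⟨ LP.length-++ (List.map (0ℚ ∷_) (corners d)) ⟩
    List.length (List.map (0ℚ ∷_) (corners d)) ℕ.+ List.length (List.map (R ∷_) (corners d))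
      ≡⟨ cong₂ ℕ._+_ (LP.length-map (0ℚ ∷_) (corners d)) (LP.length-map (R ∷_) (corners d)) ⟩
    List.length (corners d) ℕ.+ List.length (corners d)
      ≡⟨ cong (λ n → n ℕ.+ n) (length-corners d) ⟩
    2 ^ d ℕ.+ 2 ^ d
      ≡⟨ cong (2 ^ d ℕ.+_) (ℕP.+-identityʳ (2 ^ d)) ⟨
    2 ^ suc d ∎
    where open ≡-Reasoning

  corners-unique : 0ℚ ≢ R → ∀ d → Unique (corners d)
  corners-unique 0≢R zero    = [] AllPairs.∷ AllPairs.[]
  corners-unique 0≢R (suc d) = UniqueP.++⁺
    (UniqueP.map⁺ ∷-injectiveʳ (corners-unique 0≢R d))
    (UniqueP.map⁺ ∷-injectiveʳ (corners-unique 0≢R d))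
    λ (in-lower , in-upper) → case ∈-map⁻ (0ℚ ∷_) in-lower , ∈-map⁻ (R ∷_) in-upper of λ where
      ((_ , _ , refl) , (_ , _ , eq)) → 0≢R (∷-injectiveˡ eq)

  ∈-corners⇒IsCorner : ∀ d (v : Vec ℚ d) → v ∈ corners d → IsCorner R d v
  ∈-corners⇒IsCorner (suc d) v v∈ with ∈-++⁻ (List.map (0ℚ ∷_) (corners d)) v∈
  ... | inj₁ in-lower with ∈-map⁻ (0ℚ ∷_) in-lower
  ...   | u , u∈ , refl = λ { Fin.zero → inj₁ refl ; (Fin.suc i) → ∈-corners⇒IsCorner d u u∈ i }
  ∈-corners⇒IsCorner (suc d) v v∈ | inj₂ in-upper with ∈-map⁻ (R ∷_) in-upper
  ...   | u , u∈ , refl = λ { Fin.zero → inj₂ refl ; (Fin.suc i) → ∈-corners⇒IsCorner d u u∈ i }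

  IsCorner⇒∈-corners : ∀ d (v : Vec ℚ d) → IsCorner R d v → v ∈ corners d
  IsCorner⇒∈-corners zero    []      _        = here refl
  IsCorner⇒∈-corners (suc d) (x ∷ u) v-corner with v-corner Fin.zero
  ... | inj₁ refl = ∈-++⁺ˡ (∈-map⁺ (0ℚ ∷_) (IsCorner⇒∈-corners d u (v-corner ∘ Fin.suc)))
  ... | inj₂ refl = ∈-++⁺ʳ (List.map (0ℚ ∷_) (corners d)) (∈-map⁺ (R ∷_) (IsCorner⇒∈-corners d u (v-corner ∘ Fin.suc)))

  ∈-corners⇔IsCorner : ∀ d (v : Vec ℚ d) → v ∈ corners d ⇔ IsCorner R d v
  ∈-corners⇔IsCorner d v = mk⇔ (∈-corners⇒IsCorner d v) (IsCorner⇒∈-corners d v)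

indicator : Bool → ℕ
indicator b = if b then 1 else 0

indicator<2 : ∀ b → indicator b ℕ.< 2
indicator<2 true  = ℕP.≤-refl
indicator<2 false = ℕ.s≤s ℕ.z≤n

indicator-∧-≤ : ∀ a b → indicator (a ∧ b) ℕ.≤ indicator a
indicator-∧-≤ false b     = ℕ.z≤n
indicator-∧-≤ true  true  = ℕP.≤-refl
indicator-∧-≤ true  false = ℕ.z≤n

fromBits : Vec Bool d → ℕ
fromBits []      = 0
fromBits (b ∷ v) = indicator b ℕ.+ fromBits v ℕ.* 2

fromBits<2^d : (v : Vec Bool d) → fromBits v ℕ.< 2 ^ d
fromBits<2^d []               = ℕ.s≤s ℕ.z≤n
fromBits<2^d {suc d} (b ∷ v) = begin-strict
  indicator b ℕ.+ fromBits v ℕ.* 2  <⟨ ℕP.+-monoˡ-< (fromBits v ℕ.* 2) (indicator<2 b) ⟩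
  suc (fromBits v) ℕ.* 2            ≤⟨ ℕP.*-monoˡ-≤ 2 (fromBits<2^d v) ⟩
  2 ^ d ℕ.* 2                       ≡⟨ ℕP.*-comm (2 ^ d) 2 ⟩
  2 ^ suc d                         ∎
  where open ℕP.≤-Reasoning

bits-fromBits : (v : Vec Bool d) → bits d (fromBits v) ≡ v
bits-fromBits []               = refl
bits-fromBits {suc d} (b ∷ v) =
  cong₂ _∷_ (lowest-bit b) (trans (cong (bits d) higher-bits) (bits-fromBits v))
  where
  lowest-bit : ∀ b → ((indicator b ℕ.+ fromBits v ℕ.* 2) % 2 ℕ.≡ᵇ 1) ≡ b
  lowest-bit true  = cong (ℕ._≡ᵇ 1) ([m+kn]%n≡m%n 1 (fromBits v) 2)
  lowest-bit false = cong (ℕ._≡ᵇ 1) ([m+kn]%n≡m%n 0 (fromBits v) 2)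
  higher-bits : (indicator b ℕ.+ fromBits v ℕ.* 2) / 2 ≡ fromBits v
  higher-bits = begin
    (indicator b ℕ.+ fromBits v ℕ.* 2) / 2    ≡⟨ +-distrib-/-∣ʳ (indicator b) (n∣m*n (fromBits v)) ⟩
    indicator b / 2 ℕ.+ fromBits v ℕ.* 2 / 2  ≡⟨ cong₂ ℕ._+_ (m<n⇒m/n≡0 (indicator<2 b)) (m*n/n≡m (fromBits v) 2) ⟩
    fromBits v                                ∎
    where open ≡-Reasoning

columnIndex : Vec Bool d → Fin (2 ^ d)
columnIndex v = Fin.fromℕ< (fromBits<2^d v)

bits-columnIndex : (v : Vec Bool d) → bits d (toℕ (columnIndex v)) ≡ v
bits-columnIndex {d} v = trans (cong (bits d) (FinP.toℕ-fromℕ< (fromBits<2^d v))) (bits-fromBits v)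

lookup-W* : ∀ k d x (i : Fin d) → lookup (W* k d x) i ≡
  ∑[ j < k ℕ.* 2 ^ d ] indicator (lookup x j ∧ lookup (col k d j) i)
lookup-W* k d x i = trans (lookup∘tabulate _ i) (sum-map-tabulate (k ℕ.* 2 ^ d) _ id)

W*≤ones : ∀ k d x (i : Fin d) → lookup (W* k d x) i ℕ.≤ ones x
W*≤ones k d x i = begin
  lookup (W* k d x) i
    ≡⟨ lookup-W* k d x i ⟩
  ∑[ j < k ℕ.* 2 ^ d ] indicator (lookup x j ∧ lookup (col k d j) i)
    ≤⟨ sum-mono-≤ {k ℕ.* 2 ^ d} (λ j → indicator-∧-≤ (lookup x j) _) ⟩
  ∑[ j < k ℕ.* 2 ^ d ] indicator (lookup x j)
    ≡⟨ sum-map-tabulate _ indicator (lookup x) ⟨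
  ones (tabulate (lookup x))
    ≡⟨ cong ones (tabulate∘lookup x) ⟩
  ones x ∎
  where open ℕP.≤-Reasoning

WS⊆Box : ∀ k r d y → WS k r d y → Box (ℕ→ℚ r) d y
WS⊆Box k r d y (x , ones≡r , refl) i rewrite lookup-map i ℕ→ℚ (W* k d x) =
  ℕ→ℚ-mono-≤ (ℕ.z≤n {lookup (W* k d x) i}) ,
  ℕ→ℚ-mono-≤ (subst (lookup (W* k d x) i ℕ.≤_) ones≡r (W*≤ones k d x i))

-- Column j of W is bits (remainder j) and occurs as the (quotient j)-th copy; select m picks
-- the first r copies of the column with index m.
select : (r : ℕ) {k n : ℕ} → Fin n → Fin (k ℕ.* n) → Bool
select r {k} {n} m j = (toℕ (quotient {k} n j) <ᵇ r) ∧ does (remainder {k} n j Fin.≟ m)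

sum-select : ∀ {k r n} (m : Fin n) → r ℕ.≤ k → (c : Fin n → Bool) →
  ∑[ j < k ℕ.* n ] indicator (select r {k} m j ∧ c (remainder {k} n j)) ≡ r ℕ.* indicator (c m)
sum-select {k} {r} {n} m r≤k c = begin
  ∑[ j < k ℕ.* n ] indicator (select r {k} m j ∧ c (remainder {k} n j))
    ≡⟨ sum-remQuot k n (λ q ρ → indicator (((toℕ q <ᵇ r) ∧ does (ρ Fin.≟ m)) ∧ c ρ)) ⟩
  ∑[ q < k ] ∑[ ρ < n ] indicator (((toℕ q <ᵇ r) ∧ does (ρ Fin.≟ m)) ∧ c ρ)
    ≡⟨ sum-cong-≗ {k} (λ q → copy-sum (toℕ q <ᵇ r)) ⟩
  ∑[ q < k ] (if toℕ q <ᵇ r then indicator (c m) else 0)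
    ≡⟨ sum-initial-segment (indicator (c m)) r≤k ⟩
  r ℕ.* indicator (c m) ∎
  where
  open ≡-Reasoning
  off-m : ∀ ρ → ρ ≢ m → indicator (does (ρ Fin.≟ m) ∧ c ρ) ≡ 0
  off-m ρ ρ≢m = cong (λ b → indicator (b ∧ c ρ)) (dec-false (ρ Fin.≟ m) ρ≢m)
  copy-sum : ∀ a → ∑[ ρ < n ] indicator ((a ∧ does (ρ Fin.≟ m)) ∧ c ρ) ≡ (if a then indicator (c m) else 0)
  copy-sum false = sum-replicate-zero n
  copy-sum true  = trans (sum-single m (λ ρ → indicator (does (ρ Fin.≟ m) ∧ c ρ)) off-m)
                         (cong (λ b → indicator (b ∧ c m)) (dec-true (m Fin.≟ m) refl))

ones-select : ∀ {k r n} (m : Fin n) → r ℕ.≤ k → ones (tabulate (select r {k} m)) ≡ r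
ones-select {k} {r} {n} m r≤k = begin
  ones (tabulate (select r {k} m))
    ≡⟨ sum-map-tabulate (k ℕ.* n) indicator (select r {k} m) ⟩
  ∑[ j < k ℕ.* n ] indicator (select r {k} m j)
    ≡⟨ sum-cong-≗ {k ℕ.* n} (λ j → cong indicator (∧-identityʳ _)) ⟨
  ∑[ j < k ℕ.* n ] indicator (select r {k} m j ∧ true)
    ≡⟨ sum-select m r≤k (λ _ → true) ⟩
  r ℕ.* 1
    ≡⟨ ℕP.*-identityʳ r ⟩
  r ∎
  where open ≡-Reasoning

W*-select : ∀ {k r d} (v : Vec Bool d) → r ℕ.≤ k → ∀ i →
  lookup (W* k d (tabulate (select r {k} (columnIndex v)))) i ≡ r ℕ.* indicator (lookup v i)
W*-select {k} {r} {d} v r≤k i = begin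
  lookup (W* k d x) i
    ≡⟨ lookup-W* k d x i ⟩
  ∑[ j < k ℕ.* 2 ^ d ] indicator (lookup x j ∧ lookup (col k d j) i)
    ≡⟨ sum-cong-≗ {k ℕ.* 2 ^ d} (λ j → cong (λ b → indicator (b ∧ lookup (col k d j) i)) (lookup∘tabulate _ j)) ⟩
  ∑[ j < k ℕ.* 2 ^ d ] indicator (select r {k} (columnIndex v) j ∧ lookup (col k d j) i)
    ≡⟨ sum-select (columnIndex v) r≤k (λ ρ → lookup (bits d (toℕ ρ)) i) ⟩
  r ℕ.* indicator (lookup (bits d (toℕ (columnIndex v))) i)
    ≡⟨ cong (λ w → r ℕ.* indicator (lookup w i)) (bits-columnIndex v) ⟩
  r ℕ.* indicator (lookup v i) ∎
  where
  open ≡-Reasoning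
  x = tabulate (select r {k} (columnIndex v))

IsCorner⊆WS : ∀ {k r d} → r ℕ.≤ k → ∀ y → IsCorner (ℕ→ℚ r) d y → WS k r d y
IsCorner⊆WS {k} {r} {d} r≤k y y-corner = x , ones-select (columnIndex v) r≤k , lookup-ext λ i → begin
  lookup (map ℕ→ℚ (W* k d x)) i               ≡⟨ lookup-map i ℕ→ℚ (W* k d x) ⟩
  ℕ→ℚ (lookup (W* k d x) i)                   ≡⟨ cong ℕ→ℚ (W*-select v r≤k i) ⟩
  ℕ→ℚ (r ℕ.* indicator (lookup v i))          ≡⟨ cong (λ b → ℕ→ℚ (r ℕ.* indicator b)) (lookup-map i is-R y) ⟩
  ℕ→ℚ (r ℕ.* indicator (is-R (lookup y i)))  ≡⟨ coordinate (y-corner i) ⟩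
  lookup y i                                  ∎
  where
  open ≡-Reasoning
  is-R : ℚ → Bool
  is-R q = does (q ℚP.≟ ℕ→ℚ r)
  v = map is-R y
  x = tabulate (select r {k} (columnIndex v))
  coordinate : ∀ {q} → q ≡ 0ℚ ⊎ q ≡ ℕ→ℚ r → ℕ→ℚ (r ℕ.* indicator (is-R q)) ≡ q
  coordinate {q} q-corner with q ℚP.≟ ℕ→ℚ r | q-corner
  ... | yes q≡R | _        = trans (cong ℕ→ℚ (ℕP.*-identityʳ r)) (sym q≡R)
  ... | no  _   | inj₁ q≡0 = trans (cong ℕ→ℚ (ℕP.*-zeroʳ r)) (sym q≡0)
  ... | no  q≢R | inj₂ q≡R = ⊥-elim (q≢R q≡R)

-- Only 1 ≤ r (so that the cube is not a point) and r ≤ k are needed.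
proposition4p3 : (k r d : ℕ) → 1 ℕ.≤ k → 1 ℕ.≤ r → 1 ℕ.≤ d → r ℕ.≤ k →
    ((y : Vec ℚ d) → Conv (WS k r d) y ⇔ Cube r d y)
    × NumVertices (Conv (WS k r d)) (2 ^ d)
proposition4p3 k r d _ 1≤r _ r≤k =
  Conv-WS⇔Box , corners R d , corners-unique R (ℚP.<⇒≢ 0<R) d , length-corners R d , λ v →
    ⇔.trans (∈-corners⇔IsCorner R d v)
      (⇔.trans (IsCorner⇔IsVertex 0<R v) (⇔.sym (IsVertex-resp-⇔ Conv-WS⇔Box v)))
  where
  R = ℕ→ℚ r
  0<R : 0ℚ < R
  0<R = ℕ→ℚ-pos 1≤r
  Conv-WS⇔Box : ∀ y → Conv (WS k r d) y ⇔ Box R d y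
  Conv-WS⇔Box y = mk⇔ (Box-convex R y ∘ Conv-mono (WS⊆Box k r d) y)
                      (Conv-mono (IsCorner⊆WS r≤k) y ∘ Box⊆Conv-corners R 0<R d y)
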